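{- Let $\Phi_t\rightarrow_\beta\Phi_{t'}$ be a reduction step of type derivations in system $\mathcal{V}$ contracting the redex occurrence $r$ of the subject $t$ (so $t\rightarrow_\beta t'$ by contracting $r$), and let $p\in\mathrm{oc}(t)$ with $p\ne r$ and $p\ne r0$. Then $p\in\mathrm{toc}(\Phi_t)$ iff there exists $p'$ among the descendants of $p$ after $r$ such that $p'\in\mathrm{toc}(\Phi_{t'})$.
   Context: Pure $\lambda$-terms; occurrences: words over $\{0,1\}$ ($\mathrm{oc}(x)=\{\epsilon\}$, $\mathrm{oc}(t\,u)=\{\epsilon\}\cup0\cdot\mathrm{oc}(t)\cup1\cdot\mathrm{oc}(u)$, $\mathrm{oc}(\lambda x.t)=\{\epsilon\}\cup0\cdot\mathrm{oc}(t)$); redex occurrences $p$ with $t|_p=(\lambda x.s)u$. Descendants of $p$ after contracting $r$, $t|_r=(\lambda x.s)u$: $\emptyset$ if $p\in\{r,r0\}$; $\{p\}$ if $r$ is not a prefix of $p$; $\{rq\}$ if $p=r00q$; $\{rkq\mid s|_k=x\}$ if $p=r1q$. System $\mathcal{V}$: types $\tau::=\mathtt{a}\mid\alpha\mid\mathcal{M}\to\tau$ ($\mathcal{M}$ finite multisets); rules (ax) $x:[\tau]\vdash x:\tau$; (val) $\emptyset\vdash\lambda x.t:\mathtt{a}$; ($\to$i) from $\Gamma\vdash t:\tau$ infer $\Gamma\setminus x\vdash\lambda x.t:\Gamma(x)\to\tau$; ($\to$e) from $\Gamma\vdash t:[\sigma_i]_{i\in I}\to\tau$ and $(\Delta_i\vdash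 u:\sigma_i)_{i\in I}$ infer $\Gamma+\sum_i\Delta_i\vdash t\,u:\tau$. Typed occurrences $\mathrm{toc}(\Phi)$: $\{\epsilon\}$ for (ax),(val); $\{\epsilon\}\cup0\cdot\mathrm{toc}(\Phi_t)$ for ($\to$i); $\{\epsilon\}\cup0\cdot\mathrm{toc}(\Phi_t)\cup\bigcup_i1\cdot\mathrm{toc}(\Phi_u^i)$ for ($\to$e). The subderivations of $\Phi$ at $p\in\mathrm{toc}(\Phi)$ form a multiset obtained by following $0$ into the left/body premise and $1$ into all argument premises. Typed substitution $x\{\!\{(\Phi_u^i)_{i\in I}\}\!\}\Phi_s$ (defined when $\Phi_s(x)$ is the multiset of the types of the $\Phi_u^i$): replaces each (ax) on $x$ by one of the $\Phi_u^i$ of the same type (distributing the $\Phi_u^i$ nondeterministically among the premises of ($\to$e) according to the types each premise assigns to $x$), leaves other axioms unchanged, and substitutes $u$ for $x$ in untyped parts (arguments of ($\to$e) with no argument premises and bodies under (val)). Reduction of derivations: if $\Phi$ has subject $t$, $t\rightarrow_\beta t'$ by contracting $r$, and $m$ is the longest prefix of $r$ in $\mathrm{toc}(\Phi)$, then $\Phi\rightarrow_\beta\Phi'$ where $\Phi'$ is obtained by rewriting every subderivation of $\Phi$ at $m$: if $m=r$, a subderivation ending in ($\to$e) whose left premise is ($\to$i) on $\lambda x.s$ with premise $\Phi_s$ and whose argument premises are $(\Phi_u^i)_{i\in I}$ is replaced by some $x\{\!\{(\Phi_u^i)_{i\in I}\}\!\}\Phi_s$; otherwise (the redex lies inside an untyped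 argument of a ($\to$e) or inside the body of a (val)) only the subject of the subderivation is reduced, the derivation structure being unchanged. -}

module Defs where

open import Data.Nat using (ℕ; zero; suc; pred; _<ᵇ_; _≡ᵇ_)
open import Data.Bool using (Bool; true; false; if_then_else_)
open import Data.List using (List; []; _∷_; _++_; concat)
open import Data.Maybe using (Maybe; just; nothing)
open import Data.Product using (∃; _×_; _,_)
open import Data.Unit using (⊤)
open import Relation.Nullary using (¬_)
open import Relation.Binary.PropositionalEquality using (_≡_; _≢_)
open import Data.List.Relation.Binary.Permutation.Propositional using (_↭_)
open import Data.List.Membership.Propositional using (_∈_)

-- Pure λ-terms, de Bruijn indices (λx.t is  ƛ t, bound variable = index 0)

data Tm : Set where
  var : ℕ → Tm
  ƛ   : Tm → Tm
  _·_ : Tm → Tm → Tm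

shiftT : ℕ → Tm → Tm
shiftT c (var n) = var (if n <ᵇ c then n else suc n)
shiftT c (ƛ t)   = ƛ (shiftT (suc c) t)
shiftT c (t · u) = shiftT c t · shiftT c u

substV : ℕ → Tm → ℕ → Tm
substV k u n = if n <ᵇ k then var n else (if n ≡ᵇ k then u else var (pred n))

substT : ℕ → Tm → Tm → Tm
substT k u (var n) = substV k u n
substT k u (ƛ t)   = ƛ (substT (suc k) (shiftT 0 u) t)
substT k u (t · s) = substT k u t · substT k u s

data Bit : Set where
  b0 b1 : Bit

Pos : Set
Pos = List Bit

data _∈oc_ : Pos → Tm → Set where
  oc-ε   : ∀ {t} → [] ∈oc t
  oc-app0 : ∀ {p t u} → p ∈oc t → (b0 ∷ p) ∈oc (t · u)
  oc-app1 : ∀ {p t u} → p ∈oc u → (b1 ∷ p) ∈oc (t · u)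
  oc-lam0 : ∀ {p t} → p ∈oc t → (b0 ∷ p) ∈oc (ƛ t)

_∣_ : Tm → Pos → Maybe Tm
t ∣ []            = just t
(t · u) ∣ (b0 ∷ p) = t ∣ p
(t · u) ∣ (b1 ∷ p) = u ∣ p
ƛ t ∣ (b0 ∷ p)     = t ∣ p
_ ∣ (_ ∷ _)        = nothing

data _⟶[_]_ : Tm → Pos → Tm → Set where
  β-root : ∀ {s u} → (ƛ s · u) ⟶[ [] ] substT 0 u s
  β-app0 : ∀ {t t' u r} → t ⟶[ r ] t' → (t · u) ⟶[ b0 ∷ r ] (t' · u)
  β-app1 : ∀ {t u u' r} → u ⟶[ r ] u' → (t · u) ⟶[ b1 ∷ r ] (t · u')
  β-lam0 : ∀ {t t' r} → t ⟶[ r ] t' → ƛ t ⟶[ b0 ∷ r ] ƛ t'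

_≼_ : Pos → Pos → Set
r ≼ p = ∃ λ q → p ≡ r ++ q

-- BoundOcc n s k : s|_k is the variable that, at the root of s, has index n
-- (with n = 0: s|_k = x, the variable bound by the λ of λx.s)
data BoundOcc : ℕ → Tm → Pos → Set where
  bo-var  : ∀ {n} → BoundOcc n (var n) []
  bo-lam  : ∀ {n s k} → BoundOcc (suc n) s k → BoundOcc n (ƛ s) (b0 ∷ k)
  bo-app0 : ∀ {n s u k} → BoundOcc n s k → BoundOcc n (s · u) (b0 ∷ k)
  bo-app1 : ∀ {n s u k} → BoundOcc n u k → BoundOcc n (s · u) (b1 ∷ k)

data Desc (t : Tm) (r : Pos) : Pos → Pos → Set where
  d-out  : ∀ {p} → ¬ (r ≼ p) → Desc t r p p
  d-body : ∀ {s u q} → t ∣ r ≡ just (ƛ s · u) →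
           Desc t r (r ++ b0 ∷ b0 ∷ q) (r ++ q)
  d-arg  : ∀ {s u q k} → t ∣ r ≡ just (ƛ s · u) → BoundOcc 0 s k →
           Desc t r (r ++ b1 ∷ q) (r ++ k ++ q)

-- Types of system V; multisets are lists taken up to permutation
-- (recursively, via _≈T_ / _≈M_)

infixr 5 _⇒_
data Ty : Set where
  a   : Ty
  tv  : ℕ → Ty
  _⇒_ : List Ty → Ty → Ty

data _≈T_ : Ty → Ty → Set
data _≈M_ : List Ty → List Ty → Set

data _≈T_ where
  ≈a : a ≈T a
  ≈v : ∀ {n} → tv n ≈T tv n
  ≈⇒ : ∀ {M N σ τ} → M ≈M N → σ ≈T τ → (M ⇒ σ) ≈T (N ⇒ τ)

data _≈M_ where
  ≈[] : [] ≈M []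
  ≈∷  : ∀ {σ τ M N₁ N₂} → σ ≈T τ → M ≈M (N₁ ++ N₂) → (σ ∷ M) ≈M (N₁ ++ τ ∷ N₂)

Ctx : Set
Ctx = ℕ → List Ty

-- Derivations of system V as trees; the judgement Γ ⊢ t : τ at each node
-- is computed (ctx, subj, type) and well-formedness is checked by WF.

data Deriv : Set where
  ax  : ℕ → Ty → Deriv
  val : Tm → Deriv                     -- (val) ∅ ⊢ λx.b : a   (stores the body b)
  ⇒i  : Deriv → Deriv
  ⇒e  : Deriv → List Deriv → Tm → Deriv -- (→e) left premise, argument premises, argument term

subj : Deriv → Tm
subj (ax x τ)    = var x
subj (val b)     = ƛ b
subj (⇒i d)      = ƛ (subj d)
subj (⇒e d ds u) = subj d · u

ctx : Deriv → Ctx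
ctxs : List Deriv → Ctx
ctx (ax x τ) n    = if n ≡ᵇ x then τ ∷ [] else []
ctx (val b) n     = []
ctx (⇒i d) n      = ctx d (suc n)
ctx (⇒e d ds u) n = ctx d n ++ ctxs ds n
ctxs [] n       = []
ctxs (d ∷ ds) n = ctx d n ++ ctxs ds n

cod : Ty → Ty
cod (M ⇒ τ) = τ
cod _       = a

type : Deriv → Ty
type (ax x τ)    = τ
type (val b)     = a
type (⇒i d)      = ctx d 0 ⇒ type d
type (⇒e d ds u) = cod (type d)

types : List Deriv → List Ty
types []       = []
types (d ∷ ds) = type d ∷ types ds

data WF : Deriv → Set
data WFs : Tm → List Deriv → Set

data WF where
  wf-ax  : ∀ {x τ} → WF (ax x τ)
  wf-val : ∀ {b} → WF (val b)
  wf-⇒i  : ∀ {d} → WF d → WF (⇒i d)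
  wf-⇒e  : ∀ {d ds u M τ} → WF d → type d ≡ (M ⇒ τ) → types ds ≈M M →
           WFs u ds → WF (⇒e d ds u)

data WFs where
  wfs-[] : ∀ {u} → WFs u []
  wfs-∷  : ∀ {u d ds} → WF d → subj d ≡ u → WFs u ds → WFs u (d ∷ ds)

data _∈toc_ : Pos → Deriv → Set where
  toc-ε   : ∀ {Φ} → [] ∈toc Φ
  toc-i0  : ∀ {p d} → p ∈toc d → (b0 ∷ p) ∈toc (⇒i d)
  toc-e0  : ∀ {p d ds u} → p ∈toc d → (b0 ∷ p) ∈toc (⇒e d ds u)
  toc-e1  : ∀ {p d ds u e} → e ∈ ds → p ∈toc e → (b1 ∷ p) ∈toc (⇒e d ds u)

shiftV : ℕ → ℕ → ℕ
shiftV c n = if n <ᵇ c then n else suc n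

shiftD  : ℕ → Deriv → Deriv
shiftDs : ℕ → List Deriv → List Deriv
shiftD c (ax x τ)    = ax (shiftV c x) τ
shiftD c (val b)     = val (shiftT (suc c) b)
shiftD c (⇒i d)      = ⇒i (shiftD (suc c) d)
shiftD c (⇒e d ds u) = ⇒e (shiftD c d) (shiftDs c ds) (shiftT c u)
shiftDs c []       = []
shiftDs c (d ∷ ds) = shiftD c d ∷ shiftDs c ds

-- Typed substitution  x{{(Φ_u^i)_i}}Φ_s  as a (nondeterministic) relation.

data TSub  : ℕ → List Deriv → Tm → Deriv → Deriv → Set
data TSubs : ℕ → List (List Deriv) → Tm → List Deriv → List Deriv → Set

data TSub where
  ts-hit : ∀ {k u τ e} → type e ≈T τ → TSub k (e ∷ []) u (ax k τ) e
  ts-var : ∀ {k u x τ} → x ≢ k → TSub k [] u (ax x τ) (ax (if x <ᵇ k then x else pred x) τ)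
  ts-val : ∀ {k u b} → TSub k [] u (val b) (val (substT (suc k) (shiftT 0 u) b))
  ts-⇒i  : ∀ {k us u d d'} → TSub (suc k) (shiftDs 0 us) (shiftT 0 u) d d' →
           TSub k us u (⇒i d) (⇒i d')
  ts-⇒e  : ∀ {k us u d d' ds ds' w us₀ uss} → us ↭ (us₀ ++ concat uss) →
           TSub k us₀ u d d' → TSubs k uss u ds ds' →
           TSub k us u (⇒e d ds w) (⇒e d' ds' (substT k u w))

data TSubs where
  tss-[] : ∀ {k u} → TSubs k [] u [] []
  tss-∷  : ∀ {k us uss u d ds d' ds'} → TSub k us u d d' → TSubs k uss u ds ds' →
           TSubs k (us ∷ uss) u (d ∷ ds) (d' ∷ ds')

-- One descends along typed occurrences; at r (m = r) the typed
-- substitution is performed; if the redex lies in an untyped part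
-- (body of a (val), argument of (→e)) only the subject is reduced.

data DRed  : Deriv → Pos → Deriv → Set
data DReds : List Deriv → Pos → List Deriv → Set

data DRed where
  r-β   : ∀ {d ds w Φ'} → ctx d 0 ≈M types ds → TSub 0 ds w d Φ' →
          DRed (⇒e (⇒i d) ds w) [] Φ'
  r-i0  : ∀ {d d' r} → DRed d r d' → DRed (⇒i d) (b0 ∷ r) (⇒i d')
  r-val : ∀ {b b' r} → b ⟶[ r ] b' → DRed (val b) (b0 ∷ r) (val b')
  r-e0  : ∀ {d d' ds w r} → DRed d r d' → DRed (⇒e d ds w) (b0 ∷ r) (⇒e d' ds w)
  r-e1  : ∀ {d ds ds' w w' r} → DReds ds r ds' → w ⟶[ r ] w' →
          DRed (⇒e d ds w) (b1 ∷ r) (⇒e d ds' w')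

data DReds where
  rs-[] : ∀ {r} → DReds [] r []
  rs-∷  : ∀ {d d' ds ds' r} → DRed d r d' → DReds ds r ds' → DReds (d ∷ ds) r (d' ∷ ds')

-- Contracting r rewrites Φ only at r, so occurrences not below r keep their typed status.
-- Below r, the body of the redex is rebuilt by the typed substitution, which keeps the
-- skeleton of Φ_s and only replaces axioms on x (leaves of the occurrence tree): hence
-- r00q is typed in Φ iff rq is typed in Φ'.  The argument premises Φ_u^i are distributed
-- over the axioms on x, i.e. over the bound occurrences k of x in s, so r1q is typed in
-- some Φ_u^i iff rkq is typed in Φ' for some such k.  Finally r01q is no occurrence at all,
-- since t|_{r0} is an abstraction.
module Submission where

open import Defs
open import Data.Maybe using (just)
open import Data.Empty using (⊥-elim)
open import Data.List using (List; []; _∷_; _++_; concat; map)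
open import Data.List.Properties using (++-identityʳ; ∷-injectiveˡ; ∷-injectiveʳ)
open import Data.List.Membership.Propositional using (_∈_; find; lose)
open import Data.List.Membership.Propositional.Properties using (∈-map⁺; ∈-map⁻)
open import Data.List.Relation.Unary.Any using (Any; here; there)
open import Data.List.Relation.Unary.Any.Properties using (++⁺ˡ; ++⁺ʳ; ++⁻)
open import Data.List.Relation.Binary.Permutation.Propositional using (↭-sym)
open import Data.List.Relation.Binary.Permutation.Propositional.Properties using (Any-resp-↭)
open import Data.Nat using (ℕ)
open import Data.Product using (∃; ∃₂; _×_; _,_)
open import Data.Sum using (inj₁; inj₂)
open import Function using (_∘_; id)
open import Function.Bundles using (_⇔_; mk⇔; Equivalence)
open import Relation.Nullary using (¬_; Dec; yes; no)
open import Relation.Binary.Definitions using (DecidableEquality)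
open import Relation.Binary.PropositionalEquality using (_≡_; _≢_; refl; sym; cong; subst)

open Equivalence using (to; from)

private variable
  c k : ℕ
  x : Bit
  p q r : Pos
  s u u' w : Tm
  d d' Φ Φ' : Deriv
  ds ds' us : List Deriv
  uss : List (List Deriv)

_≟-bit_ : DecidableEquality Bit
b0 ≟-bit b0 = yes refl
b0 ≟-bit b1 = no λ ()
b1 ≟-bit b0 = no λ ()
b1 ≟-bit b1 = yes refl

∷-≼ : r ≼ p → (x ∷ r) ≼ (x ∷ p)
∷-≼ (q , eq) = q , cong (_ ∷_) eq

_≼?_ : ∀ r p → Dec (r ≼ p)
[]      ≼? p       = yes (p , refl)
(_ ∷ _) ≼? []      = no λ ()
(x ∷ r) ≼? (y ∷ p) with x ≟-bit y | r ≼? p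
... | yes refl | yes r≼p = yes (∷-≼ r≼p)
... | no x≢y   | _       = no λ (_ , eq) → x≢y (sym (∷-injectiveˡ eq))
... | yes _    | no r⋠p  = no λ (_ , eq) → r⋠p (_ , ∷-injectiveʳ eq)

redex-at : ∀ {t t'} → t ⟶[ r ] t' → ∃₂ λ s u → t ∣ r ≡ just (ƛ s · u)
redex-at β-root     = _ , _ , refl
redex-at (β-app0 ρ) = redex-at ρ
redex-at (β-app1 ρ) = redex-at ρ
redex-at (β-lam0 ρ) = redex-at ρ

∈oc-∣ : ∀ t r {v} → t ∣ r ≡ just v → (r ++ q) ∈oc t → q ∈oc v
∈oc-∣ t       []       refl o           = o
∈oc-∣ (t · _) (b0 ∷ r) eq   (oc-app0 o) = ∈oc-∣ t r eq o
∈oc-∣ (_ · t) (b1 ∷ r) eq   (oc-app1 o) = ∈oc-∣ t r eq o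
∈oc-∣ (ƛ t)   (b0 ∷ r) eq   (oc-lam0 o) = ∈oc-∣ t r eq o

_∈tocs_ : Pos → List Deriv → Set
p ∈tocs ds = Any (p ∈toc_) ds

toc-e1⁺ : p ∈tocs ds → (b1 ∷ p) ∈toc ⇒e d ds u
toc-e1⁺ h = let _ , m , h' = find h in toc-e1 m h'

toc-i0-cong : p ∈toc d ⇔ q ∈toc d' → (b0 ∷ p) ∈toc ⇒i d ⇔ (b0 ∷ q) ∈toc ⇒i d'
toc-i0-cong p⇔q = mk⇔ (λ { (toc-i0 h) → toc-i0 (to p⇔q h) })
                      (λ { (toc-i0 h) → toc-i0 (from p⇔q h) })

toc-e0-cong : p ∈toc d ⇔ q ∈toc d' → (b0 ∷ p) ∈toc ⇒e d ds u ⇔ (b0 ∷ q) ∈toc ⇒e d' ds' u'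
toc-e0-cong p⇔q = mk⇔ (λ { (toc-e0 h) → toc-e0 (to p⇔q h) })
                      (λ { (toc-e0 h) → toc-e0 (from p⇔q h) })

toc-e1-cong : p ∈tocs ds ⇔ q ∈tocs ds' → (b1 ∷ p) ∈toc ⇒e d ds u ⇔ (b1 ∷ q) ∈toc ⇒e d' ds' u'
toc-e1-cong p⇔q = mk⇔ (λ { (toc-e1 m h) → toc-e1⁺ (to p⇔q (lose m h)) })
                      (λ { (toc-e1 m h) → toc-e1⁺ (from p⇔q (lose m h)) })

tocs-∷-cong : p ∈toc d ⇔ q ∈toc d' → p ∈tocs ds ⇔ q ∈tocs ds' →
              p ∈tocs (d ∷ ds) ⇔ q ∈tocs (d' ∷ ds')
tocs-∷-cong hd tl = mk⇔ (λ { (here h) → here (to hd h) ; (there h) → there (to tl h) })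
                        (λ { (here h) → here (from hd h) ; (there h) → there (from tl h) })

shiftDs≡map : ∀ c ds → shiftDs c ds ≡ map (shiftD c) ds
shiftDs≡map c []       = refl
shiftDs≡map c (d ∷ ds) = cong (shiftD c d ∷_) (shiftDs≡map c ds)

shiftD-toc⁺ : q ∈toc d → q ∈toc shiftD c d
shiftD-toc⁺ toc-ε      = toc-ε
shiftD-toc⁺ (toc-i0 h) = toc-i0 (shiftD-toc⁺ h)
shiftD-toc⁺ (toc-e0 h) = toc-e0 (shiftD-toc⁺ h)
shiftD-toc⁺ {c = c} (toc-e1 {ds = ds} m h) =
  toc-e1 (subst (_ ∈_) (sym (shiftDs≡map c ds)) (∈-map⁺ (shiftD c) m)) (shiftD-toc⁺ h)

shiftD-toc⁻ : ∀ d → q ∈toc shiftD c d → q ∈toc d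
shiftD-toc⁻ (ax _ _)   toc-ε      = toc-ε
shiftD-toc⁻ (val _)    toc-ε      = toc-ε
shiftD-toc⁻ (⇒i _)     toc-ε      = toc-ε
shiftD-toc⁻ (⇒e _ _ _) toc-ε      = toc-ε
shiftD-toc⁻ (⇒i d)     (toc-i0 h) = toc-i0 (shiftD-toc⁻ d h)
shiftD-toc⁻ (⇒e d _ _) (toc-e0 h) = toc-e0 (shiftD-toc⁻ d h)
shiftD-toc⁻ {c = c} (⇒e _ ds _) (toc-e1 m h)
  with e , m' , refl ← ∈-map⁻ (shiftD c) (subst (_ ∈_) (shiftDs≡map c ds) m)
  = toc-e1 m' (shiftD-toc⁻ e h)

shiftDs-tocs⁺ : q ∈tocs ds → q ∈tocs shiftDs c ds
shiftDs-tocs⁺ {ds = _ ∷ _} (here h)  = here (shiftD-toc⁺ h)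
shiftDs-tocs⁺ {ds = _ ∷ _} (there h) = there (shiftDs-tocs⁺ h)

shiftDs-tocs⁻ : ∀ ds → q ∈tocs shiftDs c ds → q ∈tocs ds
shiftDs-tocs⁻ (d ∷ _)  (here h)  = here (shiftD-toc⁻ d h)
shiftDs-tocs⁻ (_ ∷ ds) (there h) = there (shiftDs-tocs⁻ ds h)

mutual
  tsub-toc⁺ : TSub k us u d d' → q ∈toc d → q ∈toc d'
  tsub-toc⁺ _               toc-ε        = toc-ε
  tsub-toc⁺ (ts-⇒i σ)       (toc-i0 h)   = toc-i0 (tsub-toc⁺ σ h)
  tsub-toc⁺ (ts-⇒e _ σ _)   (toc-e0 h)   = toc-e0 (tsub-toc⁺ σ h)
  tsub-toc⁺ (ts-⇒e _ _ σs)  (toc-e1 m h) = toc-e1⁺ (tsubs-tocs⁺ σs (lose m h))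

  tsubs-tocs⁺ : TSubs k uss u ds ds' → q ∈tocs ds → q ∈tocs ds'
  tsubs-tocs⁺ (tss-∷ σ _)  (here h)  = here (tsub-toc⁺ σ h)
  tsubs-tocs⁺ (tss-∷ _ σs) (there h) = there (tsubs-tocs⁺ σs h)

-- The occurrence hypothesis excludes the positions inside a substituted premise,
-- which sit below a variable of the body.
mutual
  tsub-toc⁻ : WF d → TSub k us u d d' → q ∈oc subj d → q ∈toc d' → q ∈toc d
  tsub-toc⁻ _                 (ts-hit _)     oc-ε        _            = toc-ε
  tsub-toc⁻ _                 (ts-var _)     oc-ε        _            = toc-ε
  tsub-toc⁻ _                 ts-val         _           toc-ε        = toc-ε
  tsub-toc⁻ _                 (ts-⇒i _)      _           toc-ε        = toc-ε
  tsub-toc⁻ _                 (ts-⇒e _ _ _)  _           toc-ε        = toc-ε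
  tsub-toc⁻ (wf-⇒i wf)        (ts-⇒i σ)      (oc-lam0 o) (toc-i0 h)   = toc-i0 (tsub-toc⁻ wf σ o h)
  tsub-toc⁻ (wf-⇒e wf _ _ _)  (ts-⇒e _ σ _)  (oc-app0 o) (toc-e0 h)   = toc-e0 (tsub-toc⁻ wf σ o h)
  tsub-toc⁻ (wf-⇒e _ _ _ ws)  (ts-⇒e _ _ σs) (oc-app1 o) (toc-e1 m h) =
    toc-e1⁺ (tsubs-tocs⁻ ws σs o (lose m h))

  tsubs-tocs⁻ : WFs w ds → TSubs k uss u ds ds' → q ∈oc w → q ∈tocs ds' → q ∈tocs ds
  tsubs-tocs⁻ (wfs-∷ wd refl _) (tss-∷ σ _)  o (here h)  = here (tsub-toc⁻ wd σ o h)
  tsubs-tocs⁻ (wfs-∷ _ _ ws)    (tss-∷ _ σs) o (there h) = there (tsubs-tocs⁻ ws σs o h)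

mutual
  tsub-arg-toc⁺ : WF d → TSub k us u d d' → q ∈tocs us →
                  ∃ λ j → BoundOcc k (subj d) j × (j ++ q) ∈toc d'
  tsub-arg-toc⁺ _ (ts-hit _) (here h) = [] , bo-var , h
  tsub-arg-toc⁺ (wf-⇒i wf) (ts-⇒i σ) h
    with j , bo , h' ← tsub-arg-toc⁺ wf σ (shiftDs-tocs⁺ h)
    = b0 ∷ j , bo-lam bo , toc-i0 h'
  tsub-arg-toc⁺ (wf-⇒e wf _ _ ws) (ts-⇒e {us₀ = us₀} π σ σs) h
    with ++⁻ us₀ (Any-resp-↭ π h)
  ... | inj₁ h₀ with j , bo , h' ← tsub-arg-toc⁺ wf σ h₀
    = b0 ∷ j , bo-app0 bo , toc-e0 h'
  ... | inj₂ h₁ with j , bo , h' ← tsubs-arg-tocs⁺ ws σs h₁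
    = b1 ∷ j , bo-app1 bo , toc-e1⁺ h'

  tsubs-arg-tocs⁺ : WFs w ds → TSubs k uss u ds ds' → q ∈tocs concat uss →
                    ∃ λ j → BoundOcc k w j × (j ++ q) ∈tocs ds'
  tsubs-arg-tocs⁺ (wfs-∷ wd refl ws) (tss-∷ {us = us} σ σs) h with ++⁻ us h
  ... | inj₁ h₀ with j , bo , h' ← tsub-arg-toc⁺ wd σ h₀   = j , bo , here h'
  ... | inj₂ h₁ with j , bo , h' ← tsubs-arg-tocs⁺ ws σs h₁ = j , bo , there h'

mutual
  tsub-arg-toc⁻ : ∀ {j} → WF d → TSub k us u d d' → BoundOcc k (subj d) j →
                  (j ++ q) ∈toc d' → q ∈tocs us
  tsub-arg-toc⁻ _ (ts-hit _) bo-var h = here h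
  tsub-arg-toc⁻ _ (ts-var k≢k) bo-var _ = ⊥-elim (k≢k refl)
  tsub-arg-toc⁻ _ ts-val (bo-lam _) ()
  tsub-arg-toc⁻ (wf-⇒i wf) (ts-⇒i {us = us} σ) (bo-lam bo) (toc-i0 h) =
    shiftDs-tocs⁻ us (tsub-arg-toc⁻ wf σ bo h)
  tsub-arg-toc⁻ (wf-⇒e wf _ _ _) (ts-⇒e π σ _) (bo-app0 bo) (toc-e0 h) =
    Any-resp-↭ (↭-sym π) (++⁺ˡ (tsub-arg-toc⁻ wf σ bo h))
  tsub-arg-toc⁻ (wf-⇒e _ _ _ ws) (ts-⇒e {us₀ = us₀} π _ σs) (bo-app1 bo) (toc-e1 m h) =
    Any-resp-↭ (↭-sym π) (++⁺ʳ us₀ (tsubs-arg-tocs⁻ ws σs bo (lose m h)))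

  tsubs-arg-tocs⁻ : ∀ {j} → WFs w ds → TSubs k uss u ds ds' → BoundOcc k w j →
                    (j ++ q) ∈tocs ds' → q ∈tocs concat uss
  tsubs-arg-tocs⁻ (wfs-∷ wd refl _) (tss-∷ σ _) bo (here h) = ++⁺ˡ (tsub-arg-toc⁻ wd σ bo h)
  tsubs-arg-tocs⁻ (wfs-∷ _ _ ws) (tss-∷ {us = us} _ σs) bo (there h) =
    ++⁺ʳ us (tsubs-arg-tocs⁻ ws σs bo h)

mutual
  dred-toc-outside : DRed Φ r Φ' → ¬ r ≼ p → p ∈toc Φ ⇔ p ∈toc Φ'
  dred-toc-outside {p = p}      (r-β _ _)    r⋠p = ⊥-elim (r⋠p (p , refl))
  dred-toc-outside {p = []}     _            _   = mk⇔ (λ _ → toc-ε) (λ _ → toc-ε)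
  dred-toc-outside {p = b0 ∷ _} (r-i0 ρ)     r⋠p = toc-i0-cong (dred-toc-outside ρ (r⋠p ∘ ∷-≼))
  dred-toc-outside {p = b1 ∷ _} (r-i0 _)     _   = mk⇔ (λ ()) (λ ())
  dred-toc-outside {p = _ ∷ _}  (r-val _)    _   = mk⇔ (λ ()) (λ ())
  dred-toc-outside {p = b0 ∷ _} (r-e0 ρ)     r⋠p = toc-e0-cong (dred-toc-outside ρ (r⋠p ∘ ∷-≼))
  dred-toc-outside {p = b1 ∷ _} (r-e0 _)     _   = toc-e1-cong (mk⇔ id id)
  dred-toc-outside {p = b0 ∷ _} (r-e1 _ _)   _   = toc-e0-cong (mk⇔ id id)
  dred-toc-outside {p = b1 ∷ _} (r-e1 ρs _)  r⋠p = toc-e1-cong (dreds-tocs-outside ρs (r⋠p ∘ ∷-≼))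

  dreds-tocs-outside : DReds ds r ds' → ¬ r ≼ p → p ∈tocs ds ⇔ p ∈tocs ds'
  dreds-tocs-outside rs-[]       _   = mk⇔ (λ ()) (λ ())
  dreds-tocs-outside (rs-∷ ρ ρs) r⋠p =
    tocs-∷-cong (dred-toc-outside ρ r⋠p) (dreds-tocs-outside ρs r⋠p)

mutual
  dred-toc-body : WF Φ → DRed Φ r Φ' → subj Φ ∣ r ≡ just (ƛ s · u) →
                  (r ++ b0 ∷ b0 ∷ q) ∈oc subj Φ →
                  (r ++ b0 ∷ b0 ∷ q) ∈toc Φ ⇔ (r ++ q) ∈toc Φ'
  dred-toc-body (wf-⇒e (wf-⇒i wf) _ _ _) (r-β _ σ) refl (oc-app0 (oc-lam0 o)) =
    mk⇔ (λ { (toc-e0 (toc-i0 h)) → tsub-toc⁺ σ h })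
        (λ h → toc-e0 (toc-i0 (tsub-toc⁻ wf σ o h)))
  dred-toc-body (wf-⇒i wf)         (r-i0 ρ)     eq (oc-lam0 o) = toc-i0-cong (dred-toc-body wf ρ eq o)
  dred-toc-body _                  (r-val _)    _  _           = mk⇔ (λ ()) (λ ())
  dred-toc-body (wf-⇒e wf _ _ _)   (r-e0 ρ)     eq (oc-app0 o) = toc-e0-cong (dred-toc-body wf ρ eq o)
  dred-toc-body (wf-⇒e _ _ _ ws)   (r-e1 ρs _)  eq (oc-app1 o) = toc-e1-cong (dreds-tocs-body ws ρs eq o)

  dreds-tocs-body : WFs w ds → DReds ds r ds' → w ∣ r ≡ just (ƛ s · u) →
                    (r ++ b0 ∷ b0 ∷ q) ∈oc w →
                    (r ++ b0 ∷ b0 ∷ q) ∈tocs ds ⇔ (r ++ q) ∈tocs ds'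
  dreds-tocs-body wfs-[] rs-[] _ _ = mk⇔ (λ ()) (λ ())
  dreds-tocs-body (wfs-∷ wd refl ws) (rs-∷ ρ ρs) eq o =
    tocs-∷-cong (dred-toc-body wd ρ eq o) (dreds-tocs-body ws ρs eq o)

mutual
  dred-toc-argument : WF Φ → DRed Φ r Φ' → subj Φ ∣ r ≡ just (ƛ s · u) →
                      (r ++ b1 ∷ q) ∈toc Φ ⇔ (∃ λ k → BoundOcc 0 s k × (r ++ k ++ q) ∈toc Φ')
  dred-toc-argument (wf-⇒e (wf-⇒i wf) _ _ _) (r-β _ σ) refl =
    mk⇔ (λ { (toc-e1 m h) → tsub-arg-toc⁺ wf σ (lose m h) })
        (λ (_ , bo , h) → toc-e1⁺ (tsub-arg-toc⁻ wf σ bo h))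
  dred-toc-argument (wf-⇒i wf) (r-i0 ρ) eq =
    mk⇔ (λ { (toc-i0 h) → let k , bo , h' = to ih h in k , bo , toc-i0 h' })
        (λ { (k , bo , toc-i0 h) → toc-i0 (from ih (k , bo , h)) })
    where ih = dred-toc-argument wf ρ eq
  dred-toc-argument _ (r-val _) _ = mk⇔ (λ ()) (λ { (_ , _ , ()) })
  dred-toc-argument (wf-⇒e wf _ _ _) (r-e0 ρ) eq =
    mk⇔ (λ { (toc-e0 h) → let k , bo , h' = to ih h in k , bo , toc-e0 h' })
        (λ { (k , bo , toc-e0 h) → toc-e0 (from ih (k , bo , h)) })
    where ih = dred-toc-argument wf ρ eq
  dred-toc-argument (wf-⇒e _ _ _ ws) (r-e1 ρs _) eq =
    mk⇔ (λ { (toc-e1 m h) → let k , bo , h' = to ih (lose m h) in k , bo , toc-e1⁺ h' })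
        (λ { (k , bo , toc-e1 m h) → toc-e1⁺ (from ih (k , bo , lose m h)) })
    where ih = dreds-tocs-argument ws ρs eq

  dreds-tocs-argument : WFs w ds → DReds ds r ds' → w ∣ r ≡ just (ƛ s · u) →
                        (r ++ b1 ∷ q) ∈tocs ds ⇔ (∃ λ k → BoundOcc 0 s k × (r ++ k ++ q) ∈tocs ds')
  dreds-tocs-argument wfs-[] rs-[] _ = mk⇔ (λ ()) (λ { (_ , _ , ()) })
  dreds-tocs-argument (wfs-∷ wd refl ws) (rs-∷ ρ ρs) eq =
    mk⇔ (λ { (here h)  → let k , bo , h' = to hd h in k , bo , here h'
           ; (there h) → let k , bo , h' = to tl h in k , bo , there h' })
        (λ { (k , bo , here h)  → here (from hd (k , bo , h))
           ; (k , bo , there h) → there (from tl (k , bo , h)) })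
    where hd = dred-toc-argument wd ρ eq
          tl = dreds-tocs-argument ws ρs eq

typed-below-redex-has-typed-descendant :
  WF Φ → DRed Φ r Φ' → subj Φ ∣ r ≡ just (ƛ s · u) → (r ++ q) ∈oc subj Φ →
  r ++ q ≢ r → r ++ q ≢ r ++ b0 ∷ [] → (r ++ q) ∈toc Φ →
  ∃ λ p' → Desc (subj Φ) r (r ++ q) p' × p' ∈toc Φ'
typed-below-redex-has-typed-descendant {r = r} {q = []} _ _ _ _ ≢r _ _ = ⊥-elim (≢r (++-identityʳ r))
typed-below-redex-has-typed-descendant {q = b0 ∷ []} _ _ _ _ _ ≢r0 _ = ⊥-elim (≢r0 refl)
typed-below-redex-has-typed-descendant {Φ = Φ} {r = r} {q = b0 ∷ b1 ∷ q} _ _ eq o _ _ _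
  with oc-app0 () ← ∈oc-∣ (subj Φ) r eq o
typed-below-redex-has-typed-descendant {r = r} {q = b0 ∷ b0 ∷ q} wf ρ eq o _ _ h =
  r ++ q , d-body eq , to (dred-toc-body wf ρ eq o) h
typed-below-redex-has-typed-descendant {r = r} {q = b1 ∷ q} wf ρ eq _ _ _ h =
  let k , bo , h' = to (dred-toc-argument wf ρ eq) h in r ++ k ++ q , d-arg eq bo , h'

mainTheorem10 : ∀ (t t' : Tm) (r : Pos) (Φ Φ' : Deriv) (p : Pos) →
    WF Φ → subj Φ ≡ t → t ⟶[ r ] t' → DRed Φ r Φ' →
    p ∈oc t → p ≢ r → p ≢ r ++ b0 ∷ [] →
    (p ∈toc Φ → ∃ λ p' → Desc t r p p' × p' ∈toc Φ') ×
    ((∃ λ p' → Desc t r p p' × p' ∈toc Φ') → p ∈toc Φ)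
mainTheorem10 .(subj Φ) _ r Φ Φ' p wf refl β ρ o ≢r ≢r0 = typed⇒descendant , descendant⇒typed
  where
  typed⇒descendant : p ∈toc Φ → ∃ λ p' → Desc (subj Φ) r p p' × p' ∈toc Φ'
  typed⇒descendant h with r ≼? p
  ... | no r⋠p         = p , d-out r⋠p , to (dred-toc-outside ρ r⋠p) h
  ... | yes (_ , refl) = let _ , _ , eq = redex-at β in
                         typed-below-redex-has-typed-descendant wf ρ eq o ≢r ≢r0 h

  descendant⇒typed : (∃ λ p' → Desc (subj Φ) r p p' × p' ∈toc Φ') → p ∈toc Φ
  descendant⇒typed (_ , d-out r⋠p , h)   = from (dred-toc-outside ρ r⋠p) h
  descendant⇒typed (_ , d-body eq , h)   = from (dred-toc-body wf ρ eq o) h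
  descendant⇒typed (_ , d-arg eq bo , h) = from (dred-toc-argument wf ρ eq) (_ , bo , h)
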